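{- Let $\mathcal{E}=(L|K,v)$ be a valued field extension of prime degree $q$ with $q=(vL:vK)$. Let $x\in L$ with $vx\notin vK$ be such that $\mathcal{O}_L=\bigcup_{c\in K,\ vcx>0}\mathcal{O}_K[cx]$. Then for every $x_0\in L$ with $vx_0\notin vK$ we have $I_{x_0}\subseteq I_x$.
   Context: $\mathcal{O}_K,\mathcal{O}_L$ are the valuation rings of $v$ on $K$ and $L$, and $vK\subseteq vL$ the value groups. For $y\in L$ with $vy\notin vK$, $I_y$ denotes the $\mathcal{O}_L$-ideal generated by $\{cy\mid c\in K,\ vcy>0\}$. -}

module Defs where

open import Level using (0ℓ)
open import Data.Nat using (ℕ; zero; suc)
open import Data.Fin using (Fin; suc)
open Data.Fin.Fin
import Data.Fin
import Data.Nat as ℕ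
open import Data.Product using (Σ; ∃; _×_; _,_)
open import Data.Unit using (⊤)
open import Data.Empty using (⊥)
open import Relation.Nullary using (¬_)
open import Relation.Binary.PropositionalEquality using (_≡_)
open import Algebra.Bundles using (CommutativeRing)
open import Algebra.Structures using (IsAbelianGroup)
open import Relation.Binary.Structures using (IsTotalOrder)

record OrderedAbelianGroup : Set₁ where
  field
    Carrier : Set
    _≈_ : Carrier → Carrier → Set
    _+_ : Carrier → Carrier → Carrier
    0g  : Carrier
    -_  : Carrier → Carrier
    _≤_ : Carrier → Carrier → Set
    isAbelianGroup : IsAbelianGroup _≈_ _+_ 0g -_
    isTotalOrder   : IsTotalOrder _≈_ _≤_
    +-mono-≤ : ∀ {a b} c → a ≤ b → (a + c) ≤ (b + c)

  infixl 6 _+_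
  infix 4 _≈_ _≤_

module Extended (Γ : OrderedAbelianGroup) where
  open OrderedAbelianGroup Γ

  data Γ∞ : Set where
    fin : Carrier → Γ∞
    ∞   : Γ∞

  _≈∞_ : Γ∞ → Γ∞ → Set
  fin a ≈∞ fin b = a ≈ b
  fin _ ≈∞ ∞     = ⊥
  ∞     ≈∞ fin _ = ⊥
  ∞     ≈∞ ∞     = ⊤

  _≤∞_ : Γ∞ → Γ∞ → Set
  fin a ≤∞ fin b = a ≤ b
  _     ≤∞ ∞     = ⊤
  ∞     ≤∞ fin _ = ⊥

  _<∞_ : Γ∞ → Γ∞ → Set
  a <∞ b = (a ≤∞ b) × ¬ (a ≈∞ b)

  _+∞_ : Γ∞ → Γ∞ → Γ∞
  fin a +∞ fin b = fin (a + b)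
  _     +∞ _     = ∞

  infix 4 _≈∞_ _≤∞_ _<∞_
  infixl 6 _+∞_

record ValuedFieldExtension : Set₂ where
  field
    L : CommutativeRing 0ℓ 0ℓ
  open CommutativeRing L public hiding (zero)
  field
    1≉0     : ¬ (1# ≈ 0#)
    L-inv   : ∀ x → ¬ (x ≈ 0#) → ∃ λ y → x * y ≈ 1#
    inK      : Carrier → Set
    inK-cong : ∀ {x y} → x ≈ y → inK x → inK y
    inK-0    : inK 0#
    inK-1    : inK 1#
    inK-+    : ∀ {x y} → inK x → inK y → inK (x + y)
    inK-*    : ∀ {x y} → inK x → inK y → inK (x * y)
    inK--    : ∀ {x} → inK x → inK (- x)
    inK-inv  : ∀ {x} → inK x → ¬ (x ≈ 0#) → ∃ λ y → inK y × (x * y ≈ 1#)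
    Γ : OrderedAbelianGroup
  open Extended Γ public
  private module G = OrderedAbelianGroup Γ
  field
    v       : Carrier → Γ∞
    v-cong  : ∀ {x y} → x ≈ y → v x ≈∞ v y
    v-0     : v 0# ≡ ∞
    v-∞     : ∀ {x} → v x ≡ ∞ → x ≈ 0#
    v-*     : ∀ x y → v (x * y) ≈∞ v x +∞ v y
    v-+     : ∀ x y γ → γ ≤∞ v x → γ ≤∞ v y → γ ≤∞ v (x + y)

  ΓC : Set
  ΓC = G.Carrier

  Σ[_] : ∀ {n} → (Fin n → Carrier) → Carrier
  Σ[_] {ℕ.zero}  f = 0#
  Σ[_] {ℕ.suc n} f = f Fin.zero + Σ[ (λ i → f (suc i)) ]

  _^_ : Carrier → ℕ → Carrier
  y ^ ℕ.zero  = 1#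
  y ^ ℕ.suc n = y * (y ^ n)

  inOL : Carrier → Set
  inOL y = fin G.0g ≤∞ v y

  inOK : Carrier → Set
  inOK y = inK y × inOL y

  invL : ΓC → Set
  invL δ = ∃ λ y → v y ≈∞ fin δ

  invK : ΓC → Set
  invK δ = ∃ λ c → inK c × (v c ≈∞ fin δ)

  -- "v y ∉ vK" (this also forces y ≠ 0, as v 0 = ∞ = v 0 with 0 ∈ K)
  vNotInvK : Carrier → Set
  vNotInvK y = ¬ (∃ λ c → inK c × (v c ≈∞ v y))

  DegreeIs : ℕ → Set
  DegreeIs q = ∃ λ (b : Fin q → Carrier) →
      (∀ (a : Fin q → Carrier) → (∀ i → inK (a i)) →
          Σ[ (λ i → a i * b i) ] ≈ 0# → ∀ i → a i ≈ 0#)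
    × (∀ y → ∃ λ (a : Fin q → Carrier) → (∀ i → inK (a i))
                 × (y ≈ Σ[ (λ i → a i * b i) ]))

  IndexIs : ℕ → Set
  IndexIs q = ∃ λ (γ : Fin q → ΓC) →
      (∀ i → invL (γ i))
    × (∀ δ → invL δ → ∃ λ i → ∃ λ κ → invK κ × (δ G.≈ γ i G.+ κ))
    × (∀ i j → invK (γ i G.+ G.- (γ j)) → i ≡ j)

  inOK[_] : Carrier → Carrier → Set
  inOK[ y ] z = ∃ λ n → ∃ λ (a : Fin n → Carrier) →
      (∀ i → inOK (a i)) × (z ≈ Σ[ (λ i → a i * (y ^ Data.Fin.toℕ i)) ])

  IsGen : Carrier → Carrier → Set
  IsGen y c = inK c × (fin G.0g <∞ v (c * y))

  inI : Carrier → Carrier → Set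
  inI y z = ∃ λ n → ∃ λ (r : Fin n → Carrier) → ∃ λ (c : Fin n → Carrier) →
      (∀ i → inOL (r i)) × (∀ i → IsGen y (c i))
    × (z ≈ Σ[ (λ i → r i * (c i * y)) ])

  OLIsUnion : Carrier → Set
  OLIsUnion x = ∀ z → (inOL z → ∃ λ c → IsGen x c × inOK[ c * x ] z)
                    × ((∃ λ c → IsGen x c × inOK[ c * x ] z) → inOL z)

{-# OPTIONS --safe #-}
-- Let c₀x₀ be a generator of I_{x₀}, c₀ ≠ 0. It lies in O_L, hence in some O_K[cx] with
-- v(cx) > 0, so c₀x₀ = a + s with a ∈ K and v s ≥ v(cx). Since v(c₀x₀) ∉ vK we have
-- v(c₀x₀) ≠ v a, and the ultrametric inequality forces v(c₀x₀) ≥ v s ≥ v(cx); so c₀x₀ is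
-- an O_L-multiple of the generator cx of I_x. Neither the degree and index hypotheses
-- nor vx ∉ vK are needed.
module Submission where

open import Defs
open import Level using (0ℓ)
open import Data.Nat using (ℕ; zero; suc)
open import Data.Nat.Primality using (Prime)
open import Data.Fin using (Fin; zero; suc; toℕ)
open import Data.Product using (∃; _×_; _,_; proj₁; proj₂)
open import Data.Sum using (_⊎_; inj₁; inj₂; fromInj₁)
open import Data.Unit using (tt)
open import Data.Empty using (⊥-elim)
open import Function using (_∘_)
open import Relation.Nullary using (¬_)
open import Relation.Binary.PropositionalEquality using (_≡_; subst; subst₂)
import Relation.Binary.PropositionalEquality as ≡
open import Relation.Binary.Bundles using (Poset)
open import Relation.Binary.Definitions using (Maximum; Total)
open import Relation.Binary.Structures using (IsEquivalence; IsTotalOrder)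
open import Algebra.Bundles using (Group)
open import Algebra.Structures using (IsAbelianGroup)
import Algebra.Properties.Group as GroupProperties
import Algebra.Properties.Ring as RingProperties
import Relation.Binary.Reasoning.PartialOrder as PosetReasoning
import Relation.Binary.Reasoning.Setoid as SetoidReasoning

-- _≈∞_ and _≤∞_ compute on their arguments, so Agda cannot recover the points of a proof
-- from its type: those implicit arguments are passed explicitly throughout.
module ExtendedOrder (Γ : OrderedAbelianGroup) where
  open OrderedAbelianGroup Γ
  open Extended Γ
  private
    module O = IsTotalOrder isTotalOrder

    group : Group 0ℓ 0ℓ
    group = record { isGroup = IsAbelianGroup.isGroup isAbelianGroup }

  open Group group using ()
    renaming (refl to ≈-refl; sym to ≈-sym; trans to ≈-trans; ∙-cong to +-cong; identityˡ to +-identityˡ)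
  open GroupProperties group using (identityˡ-unique)

  ≈∞-refl : ∀ {a} → a ≈∞ a
  ≈∞-refl {fin a} = ≈-refl
  ≈∞-refl {∞}     = tt

  ≈∞-sym : ∀ {a b} → a ≈∞ b → b ≈∞ a
  ≈∞-sym {fin a} {fin b} = ≈-sym
  ≈∞-sym {∞}     {∞}     = _

  ≈∞-trans : ∀ {a b c} → a ≈∞ b → b ≈∞ c → a ≈∞ c
  ≈∞-trans {fin a} {fin b} {fin c} = ≈-trans
  ≈∞-trans {∞}     {∞}     {∞}     = _

  ≈∞-isEquivalence : IsEquivalence _≈∞_
  ≈∞-isEquivalence = record
    { refl  = λ {a} → ≈∞-refl {a}
    ; sym   = λ {a} {b} → ≈∞-sym {a} {b}
    ; trans = λ {a} {b} {c} → ≈∞-trans {a} {b} {c}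
    }

  ≤∞-maximum : Maximum _≤∞_ ∞
  ≤∞-maximum (fin _) = tt
  ≤∞-maximum ∞       = tt

  ≤∞-reflexive : ∀ {a b} → a ≈∞ b → a ≤∞ b
  ≤∞-reflexive {fin a} {fin b} = O.reflexive
  ≤∞-reflexive {∞}     {∞}     = _

  ≤∞-refl : ∀ a → a ≤∞ a
  ≤∞-refl a = ≤∞-reflexive {a} {a} (≈∞-refl {a})

  ≤∞-trans : ∀ {a b c} → a ≤∞ b → b ≤∞ c → a ≤∞ c
  ≤∞-trans {a}     {b}     {∞}     _ _ = ≤∞-maximum a
  ≤∞-trans {fin a} {fin b} {fin c}     = O.trans

  ≤∞-antisym : ∀ {a b} → a ≤∞ b → b ≤∞ a → a ≈∞ b
  ≤∞-antisym {fin a} {fin b} = O.antisym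
  ≤∞-antisym {∞}     {∞}     _ _ = tt

  ≤∞-total : Total _≤∞_
  ≤∞-total (fin a) (fin b) = O.total a b
  ≤∞-total a       ∞       = inj₁ (≤∞-maximum a)
  ≤∞-total ∞       b       = inj₂ (≤∞-maximum b)

  ≤∞-isTotalOrder : IsTotalOrder _≈∞_ _≤∞_
  ≤∞-isTotalOrder = record
    { isPartialOrder = record
      { isPreorder = record
        { isEquivalence = ≈∞-isEquivalence
        ; reflexive     = λ {a} {b} → ≤∞-reflexive {a} {b}
        ; trans         = λ {a} {b} {c} → ≤∞-trans {a} {b} {c}
        }
      ; antisym = λ {a} {b} → ≤∞-antisym {a} {b}
      }
    ; total = ≤∞-total
    }

  ≤∞-poset : Poset 0ℓ 0ℓ 0ℓ
  ≤∞-poset = record { isPartialOrder = IsTotalOrder.isPartialOrder ≤∞-isTotalOrder }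

  +∞-congˡ : ∀ a {b b′} → b ≈∞ b′ → a +∞ b ≈∞ a +∞ b′
  +∞-congˡ (fin a) {fin b} {fin b′} = +-cong ≈-refl
  +∞-congˡ (fin a) {∞}     {∞}      _ = tt
  +∞-congˡ ∞                        _ = tt

  ∞≤x⇒x≡∞ : ∀ x → ∞ ≤∞ x → x ≡ ∞
  ∞≤x⇒x≡∞ ∞ _ = ≡.refl

  +∞-monoˡ-≤ : ∀ c {a b} → a ≤∞ b → a +∞ c ≤∞ b +∞ c
  +∞-monoˡ-≤ (fin c) {fin a} {fin b} = +-mono-≤ c
  +∞-monoˡ-≤ ∞       {fin a} {fin b} _ = tt
  +∞-monoˡ-≤ c       {a}     {∞}     _ = ≤∞-maximum (a +∞ c)

  x≤y+∞x : ∀ {y} x → fin 0g ≤∞ y → x ≤∞ y +∞ x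
  x≤y+∞x {fin y} (fin x) 0≤y = O.trans (O.reflexive (≈-sym (+-identityˡ x))) (+-mono-≤ x 0≤y)
  x≤y+∞x {fin y} ∞       _   = tt
  x≤y+∞x {∞}     x       _   = ≤∞-maximum x

  x+∞x≈x⇒x≈0⊎x≡∞ : ∀ x → x +∞ x ≈∞ x → x ≈∞ fin 0g ⊎ x ≡ ∞
  x+∞x≈x⇒x≈0⊎x≡∞ (fin x) x+x≈x = inj₁ (identityˡ-unique x x x+x≈x)
  x+∞x≈x⇒x≈0⊎x≡∞ ∞       _     = inj₂ ≡.refl

  x+∞x≈0⇒0≤x : ∀ x → x +∞ x ≈∞ fin 0g → fin 0g ≤∞ x
  x+∞x≈0⇒0≤x (fin x) x+x≈0 with O.total 0g x
  ... | inj₁ 0≤x = 0≤x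
  ... | inj₂ x≤0 = O.trans (O.reflexive (≈-sym x+x≈0))
                     (O.trans (+-mono-≤ x x≤0) (O.reflexive (+-identityˡ x)))
  x+∞x≈0⇒0≤x ∞       _     = tt

module Valuation (E : ValuedFieldExtension) where
  open ValuedFieldExtension E
  open ExtendedOrder Γ
  open RingProperties ring using (-1*x≈-x; -‿involutive)
  open OrderedAbelianGroup Γ using (0g)
  module ≤∞-Reasoning = PosetReasoning ≤∞-poset

  ≤-v-0# : ∀ γ → γ ≤∞ v 0#
  ≤-v-0# γ = subst (γ ≤∞_) (≡.sym v-0) (≤∞-maximum γ)

  v≡∞⊎≉0 : ∀ y → v y ≡ ∞ ⊎ ¬ y ≈ 0#
  v≡∞⊎≉0 y with v y in vy≡
  ... | ∞     = inj₁ ≡.refl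
  ... | fin _ = inj₂ λ y≈0 → subst₂ _≈∞_ vy≡ v-0 (v-cong y≈0)

  v-1# : v 1# ≈∞ fin 0g
  v-1# = fromInj₁ (⊥-elim ∘ 1≉0 ∘ v-∞) (x+∞x≈x⇒x≈0⊎x≡∞ (v 1#) v1+v1≈v1)
    where
    open ≤∞-Reasoning
    v1+v1≈v1 : v 1# +∞ v 1# ≈∞ v 1#
    v1+v1≈v1 = begin-equality
      v 1# +∞ v 1#  ≈⟨ v-* 1# 1# ⟨
      v (1# * 1#)   ≈⟨ v-cong (*-identityˡ 1#) ⟩
      v 1#          ∎

  inOL-1# : inOL 1#
  inOL-1# = ≤∞-reflexive {fin 0g} {v 1#} (≈∞-sym {v 1#} v-1#)

  inOL-‿1# : inOL (- 1#)
  inOL-‿1# = x+∞x≈0⇒0≤x (v (- 1#)) (begin-equality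
    v (- 1#) +∞ v (- 1#)  ≈⟨ v-* (- 1#) (- 1#) ⟨
    v (- 1# * - 1#)       ≈⟨ v-cong (-1*x≈-x (- 1#)) ⟩
    v (- - 1#)            ≈⟨ v-cong (-‿involutive 1#) ⟩
    v 1#                  ≈⟨ v-1# ⟩
    fin 0g                ∎)
    where open ≤∞-Reasoning

  ≤-v-*ˡ : ∀ {u} w → inOL u → v w ≤∞ v (u * w)
  ≤-v-*ˡ {u} w u∈OL = begin
    v w           ≤⟨ x≤y+∞x (v w) u∈OL ⟩
    v u +∞ v w    ≈⟨ v-* u w ⟨
    v (u * w)     ∎
    where open ≤∞-Reasoning

  inOL-* : ∀ {a b} → inOL a → inOL b → inOL (a * b)
  inOL-* {a} {b} a∈OL b∈OL = begin
    fin 0g     ≤⟨ b∈OL ⟩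
    v b        ≤⟨ ≤-v-*ˡ b a∈OL ⟩
    v (a * b)  ∎
    where open ≤∞-Reasoning

  inOL-^ : ∀ {w} k → inOL w → inOL (w ^ k)
  inOL-^ zero    _    = inOL-1#
  inOL-^ (suc k) w∈OL = inOL-* w∈OL (inOL-^ k w∈OL)

  ≤-v-‿ : ∀ s → v s ≤∞ v (- s)
  ≤-v-‿ s = begin
    v s           ≤⟨ ≤-v-*ˡ s inOL-‿1# ⟩
    v (- 1# * s)  ≈⟨ v-cong (-1*x≈-x s) ⟩
    v (- s)       ∎
    where open ≤∞-Reasoning

  v-+-dichotomy : ∀ a b → v (a + b) ≈∞ v a ⊎ v b ≤∞ v (a + b)
  v-+-dichotomy a b with ≤∞-total (v b) (v a)
  ... | inj₁ vb≤va = inj₂ (v-+ a b (v b) vb≤va (≤∞-refl (v b)))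
  ... | inj₂ va≤vb with ≤∞-total (v b) (v (a + b))
  ...   | inj₁ vb≤v[a+b] = inj₂ vb≤v[a+b]
  ...   | inj₂ v[a+b]≤vb = inj₁ (≤∞-antisym {v (a + b)} {v a} v[a+b]≤va va≤v[a+b])
    where
    open ≤∞-Reasoning
    va≤v[a+b] : v a ≤∞ v (a + b)
    va≤v[a+b] = v-+ a b (v a) (≤∞-refl (v a)) va≤vb
    a+b-b≈a : (a + b) + - b ≈ a
    a+b-b≈a = trans (+-assoc a b (- b)) (trans (+-congˡ (-‿inverseʳ b)) (+-identityʳ a))
    v[a+b]≤va : v (a + b) ≤∞ v a
    v[a+b]≤va = begin
      v (a + b)            ≤⟨ v-+ (a + b) (- b) (v (a + b)) (≤∞-refl (v (a + b)))
                                (begin v (a + b) ≤⟨ v[a+b]≤vb ⟩ v b ≤⟨ ≤-v-‿ b ⟩ v (- b) ∎) ⟩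
      v ((a + b) + - b)    ≈⟨ v-cong a+b-b≈a ⟩
      v a                  ∎

  ≤-v-Σ : ∀ γ {n} (f : Fin n → Carrier) → (∀ i → γ ≤∞ v (f i)) → γ ≤∞ v Σ[ f ]
  ≤-v-Σ γ {zero}  f _   = ≤-v-0# γ
  ≤-v-Σ γ {suc n} f γ≤f = v-+ _ _ γ (γ≤f zero) (≤-v-Σ γ (f ∘ suc) (γ≤f ∘ suc))

  Σ-cong : ∀ {n} {f g : Fin n → Carrier} → (∀ i → f i ≈ g i) → Σ[ f ] ≈ Σ[ g ]
  Σ-cong {zero}  _   = refl
  Σ-cong {suc n} f≈g = +-cong (f≈g zero) (Σ-cong (f≈g ∘ suc))

  inOK[]-split : ∀ {w y} → inOL w → inOK[ w ] y →
                 ∃ λ a → inK a × ∃ λ s → v w ≤∞ v s × y ≈ a + s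
  inOK[]-split {w} _ (zero , _ , _ , y≈0) =
    0# , inK-0 , 0# , ≤-v-0# (v w) , trans y≈0 (sym (+-identityˡ 0#))
  inOK[]-split {w} w∈OL (suc n , a , a∈OK , y≈Σ) =
    a zero * 1# , inK-* (proj₁ (a∈OK zero)) inK-1 , _ , ≤-v-Σ (v w) _ vw≤term , y≈Σ
    where
    open ≤∞-Reasoning
    vw≤term : ∀ (i : Fin n) → v w ≤∞ v (a (suc i) * (w * w ^ toℕ i))
    vw≤term i = begin
      v w                                 ≤⟨ ≤-v-*ˡ w (inOL-* (proj₂ (a∈OK (suc i))) (inOL-^ (toℕ i) w∈OL)) ⟩
      v ((a (suc i) * w ^ toℕ i) * w)     ≈⟨ v-cong (trans (*-assoc _ _ _) (*-congˡ (*-comm _ _))) ⟩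
      v (a (suc i) * (w * w ^ toℕ i))     ∎

  infix 4 _∣ᴼ_
  record _∣ᴼ_ (w y : Carrier) : Set where
    constructor divides
    field
      quotient    : Carrier
      quotient∈OL : inOL quotient
      equality    : y ≈ quotient * w

  ≤-v⇒∣ᴼ : ∀ {w y} → v w ≤∞ v y → w ∣ᴼ y
  ≤-v⇒∣ᴼ {w} {y} vw≤vy with v≡∞⊎≉0 w
  ... | inj₁ vw≡∞ = divides 0# (≤-v-0# (fin 0g)) (trans y≈0 (sym (zeroˡ w)))
    where
    y≈0 : y ≈ 0#
    y≈0 = v-∞ (∞≤x⇒x≡∞ (v y) (subst (_≤∞ v y) vw≡∞ vw≤vy))
  ... | inj₂ w≉0 with L-inv w w≉0
  ...   | w⁻¹ , ww⁻¹≈1 = divides (y * w⁻¹) yw⁻¹∈OL yw⁻¹w≈y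
    where
    yw⁻¹∈OL : inOL (y * w⁻¹)
    yw⁻¹∈OL = begin
      fin 0g          ≈⟨ v-1# ⟨
      v 1#            ≈⟨ v-cong ww⁻¹≈1 ⟨
      v (w * w⁻¹)     ≈⟨ v-* w w⁻¹ ⟩
      v w +∞ v w⁻¹    ≤⟨ +∞-monoˡ-≤ (v w⁻¹) {v w} {v y} vw≤vy ⟩
      v y +∞ v w⁻¹    ≈⟨ v-* y w⁻¹ ⟨
      v (y * w⁻¹)     ∎
      where open ≤∞-Reasoning
    yw⁻¹w≈y : y ≈ (y * w⁻¹) * w
    yw⁻¹w≈y = sym (begin
      (y * w⁻¹) * w   ≈⟨ *-assoc y w⁻¹ w ⟩
      y * (w⁻¹ * w)   ≈⟨ *-congˡ (*-comm w⁻¹ w) ⟩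
      y * (w * w⁻¹)   ≈⟨ *-congˡ ww⁻¹≈1 ⟩
      y * 1#          ≈⟨ *-identityʳ y ⟩
      y               ∎)
      where open SetoidReasoning setoid

  vNotInvK-*ˡ : ∀ {c y} → inK c → ¬ c ≈ 0# → vNotInvK y → vNotInvK (c * y)
  vNotInvK-*ˡ {c} {y} c∈K c≉0 vy∉vK (d , d∈K , vd≈v[cy]) with inK-inv c∈K c≉0
  ... | c⁻¹ , c⁻¹∈K , cc⁻¹≈1 = vy∉vK (c⁻¹ * d , inK-* c⁻¹∈K d∈K , v[c⁻¹d]≈vy)
    where
    c⁻¹cy≈y : c⁻¹ * (c * y) ≈ y
    c⁻¹cy≈y = begin
      c⁻¹ * (c * y)   ≈⟨ *-assoc c⁻¹ c y ⟨
      (c⁻¹ * c) * y   ≈⟨ *-congʳ (*-comm c⁻¹ c) ⟩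
      (c * c⁻¹) * y   ≈⟨ *-congʳ cc⁻¹≈1 ⟩
      1# * y          ≈⟨ *-identityˡ y ⟩
      y               ∎
      where open SetoidReasoning setoid
    v[c⁻¹d]≈vy : v (c⁻¹ * d) ≈∞ v y
    v[c⁻¹d]≈vy = begin-equality
      v (c⁻¹ * d)             ≈⟨ v-* c⁻¹ d ⟩
      v c⁻¹ +∞ v d            ≈⟨ +∞-congˡ (v c⁻¹) {v d} {v (c * y)} vd≈v[cy] ⟩
      v c⁻¹ +∞ v (c * y)      ≈⟨ v-* c⁻¹ (c * y) ⟨
      v (c⁻¹ * (c * y))       ≈⟨ v-cong c⁻¹cy≈y ⟩
      v y                     ∎
      where open ≤∞-Reasoning

  ≤-v-inOK[] : ∀ {w y} → vNotInvK y → inOL w → inOK[ w ] y → v w ≤∞ v y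
  ≤-v-inOK[] {w} {y} vy∉vK w∈OL y∈OK[w] with inOK[]-split w∈OL y∈OK[w]
  ... | a , a∈K , s , vw≤vs , y≈a+s with v-+-dichotomy a s
  ... | inj₁ v[a+s]≈va = ⊥-elim (vy∉vK (a , a∈K , va≈vy))
    where
    open ≤∞-Reasoning
    va≈vy : v a ≈∞ v y
    va≈vy = begin-equality
      v a        ≈⟨ v[a+s]≈va ⟨
      v (a + s)  ≈⟨ v-cong y≈a+s ⟨
      v y        ∎
  ... | inj₂ vs≤v[a+s] = begin
      v w        ≤⟨ vw≤vs ⟩
      v s        ≤⟨ vs≤v[a+s] ⟩
      v (a + s)  ≈⟨ v-cong y≈a+s ⟨
      v y        ∎
    where open ≤∞-Reasoning

  record GenDivides (x y : Carrier) : Set where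
    field
      c     : Carrier
      isGen : IsGen x c
      gen∣y : c * x ∣ᴼ y

  gen-divides-gen : ∀ {x x₀ c₀} → OLIsUnion x → vNotInvK x₀ → IsGen x₀ c₀ →
                    GenDivides x (c₀ * x₀)
  gen-divides-gen {x} {x₀} {c₀} OL-union vx₀∉vK (c₀∈K , 0≤v[c₀x₀] , _)
    with proj₁ (OL-union (c₀ * x₀)) 0≤v[c₀x₀]
  ... | c , c-gen@(_ , 0≤v[cx] , _) , c₀x₀∈OK[cx] = record
    { c = c ; isGen = c-gen ; gen∣y = ≤-v⇒∣ᴼ v[cx]≤v[c₀x₀] }
    where
    v[cx]≤v[c₀x₀] : v (c * x) ≤∞ v (c₀ * x₀)
    v[cx]≤v[c₀x₀] with v≡∞⊎≉0 (c₀ * x₀)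
    ... | inj₁ v[c₀x₀]≡∞ = subst (v (c * x) ≤∞_) (≡.sym v[c₀x₀]≡∞) (≤∞-maximum (v (c * x)))
    ... | inj₂ c₀x₀≉0    = ≤-v-inOK[] (vNotInvK-*ˡ c₀∈K c₀≉0 vx₀∉vK) 0≤v[cx] c₀x₀∈OK[cx]
      where
      c₀≉0 : ¬ c₀ ≈ 0#
      c₀≉0 c₀≈0 = c₀x₀≉0 (trans (*-congʳ c₀≈0) (zeroˡ x₀))

  inI-⊆ : ∀ {x x₀} → (∀ c₀ → IsGen x₀ c₀ → GenDivides x (c₀ * x₀)) →
          ∀ z → inI x₀ z → inI x z
  inI-⊆ gen-divides z (n , r , c₀ , r∈OL , c₀-gen , z≈Σ) =
    n , (λ i → r i * Q.quotient i) , D.c , (λ i → inOL-* (r∈OL i) (Q.quotient∈OL i)) , D.isGen ,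
    trans z≈Σ (Σ-cong λ i → trans (*-congˡ (Q.equality i)) (sym (*-assoc _ _ _)))
    where
    module D (i : Fin n) = GenDivides (gen-divides (c₀ i) (c₀-gen i))
    module Q (i : Fin n) = _∣ᴼ_ (D.gen∣y i)

lemma5p4 : (E : ValuedFieldExtension) → let open ValuedFieldExtension E in
    (q : ℕ) → Prime q → DegreeIs q → IndexIs q →
    (x : Carrier) → vNotInvK x → OLIsUnion x →
    (x₀ : Carrier) → vNotInvK x₀ →
    ∀ z → inI x₀ z → inI x z
lemma5p4 E _ _ _ _ _ _ OL-union _ vx₀∉vK = inI-⊆ (λ _ → gen-divides-gen OL-union vx₀∉vK)
  where open Valuation E
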